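{- Algebras $H_1,H_2\in\Theta$ are LG-equivalent if and only if they are LG-isotypic.
   Context: Fix a variety $\Theta$, an infinite set of variables $X^0$, and let $\Gamma$ be the set of finite subsets of $X^0$; $W(X)$ is the free algebra of $\Theta$ over $X$. For $H\in\Theta$, $\mathrm{Hal}^X_\Theta(H)$ is the Boolean algebra of subsets of $\mathrm{Hom}(W(X),H)$ with quantifiers ($\mu\in\exists xA$ iff some $\nu\in A$ agrees with $\mu$ off $x$), equalities $[w\equiv w']_H=\{\mu:\mu(w)=\mu(w')\}$ and maps $s_*(A)=\{\mu:\mu\circ s\in A\}$ for homomorphisms $s:W(X)\to W(Y)$. The multi-sorted algebra of formulas $\Phi=(\Phi(X),X\in\Gamma)$ is the free Halmos algebra (multi-sorted algebras with sorts extended Boolean algebras with quantifiers $\exists x$, equalities $w\equiv w'$, and operations $s_*$, satisfying the Halmos axioms) over the sets of formal equalities $w\equiv w'$, $w,w'\in W(X)$; $\mathrm{Val}^X_H:\Phi(X)\to\mathrm{Hal}^X_\Theta(H)$ are the components of the unique homomorphism sending $w\equiv w'$ to $[w\equiv w']_H$. A point $\mu:W(X)\to H$ satisfies $u$ iff $\mu\in\mathrm{Val}^X_H(u)$; the logical kernel $\mathrm{LKer}(\mu)$ is the set of formulas in $\Phi(X)$ satisfied by $\mu$. For $T\subseteq\Phi(X)$, $T^L_H=\{\mu:T\subseteq\mathrm{LKer}(\mu)\}$, for $A\subseteq\mathrm{Hom}(W(X),H)$, $A^L_H=\bigcap_{\mu\in A}\mathrm{LKer}(\mu)$, $T^{LL}_H=(T^L_H)^L_H$.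 $H_1,H_2$ are LG-equivalent iff $T^{LL}_{H_1}=T^{LL}_{H_2}$ for all $X\in\Gamma$, $T\subseteq\Phi(X)$. $H_1,H_2$ are LG-isotypic iff for every $X\in\Gamma$, for every point $\mu:W(X)\to H_1$ there is a point $\nu:W(X)\to H_2$ with $\mathrm{LKer}(\mu)=\mathrm{LKer}(\nu)$, and conversely for every $\nu:W(X)\to H_2$ there is $\mu:W(X)\to H_1$ with $\mathrm{LKer}(\nu)=\mathrm{LKer}(\mu)$. -}

module Defs where

open import Level using (0ℓ)
open import Data.Nat using (ℕ)
open import Data.Fin using (Fin)
open import Data.List using (List)
open import Data.List.Membership.Propositional using (_∈_)
open import Data.List.Relation.Unary.Unique.Propositional using (Unique)
open import Data.Product using (Σ; ∃; _×_; _,_; proj₁)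
open import Data.Sum using (_⊎_)
open import Data.Unit using (⊤)
open import Data.Empty using (⊥)
open import Relation.Nullary using (¬_)
open import Relation.Unary using (Pred; _≐_)
open import Relation.Binary.PropositionalEquality using (_≡_; _≢_)

record Signature : Set₁ where
  field
    Op    : Set
    arity : Op → ℕ
open Signature public

data Term (S : Signature) (V : Set) : Set where
  var : V → Term S V
  op  : (f : Op S) → (Fin (arity S f) → Term S V) → Term S V

record Algebra (S : Signature) : Set₁ where
  field
    Carrier : Set
    ⟦_⟧     : (f : Op S) → (Fin (arity S f) → Carrier) → Carrier
open Algebra public

eval : {S : Signature} (A : Algebra S) {V : Set} → (V → Carrier A) → Term S V → Carrier A
eval A ρ (var x)   = ρ x
eval A ρ (op f ts) = ⟦ A ⟧ f (λ i → eval A ρ (ts i))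

record Variety : Set₁ where
  field
    sig : Signature
    Eqn : Set
    lhs : Eqn → Term sig ℕ
    rhs : Eqn → Term sig ℕ
open Variety public

InΘ : (Θ : Variety) → Algebra (sig Θ) → Set
InΘ Θ H = (e : Eqn Θ) (ρ : ℕ → Carrier H) → eval H ρ (lhs Θ e) ≡ eval H ρ (rhs Θ e)

-- Variables: X⁰ = ℕ; Γ = finite subsets of X⁰, represented by
-- duplicate-free lists of naturals.

record FinSub : Set where
  constructor finSub
  field
    elems  : List ℕ
    unique : Unique elems
open FinSub public

Var : FinSub → Set
Var X = Σ ℕ (λ x → x ∈ elems X)

module Logic (Θ : Variety) where

  -- W(X): elements represented by terms over the variables of X
  W : FinSub → Set
  W X = Term (sig Θ) (Var X)

  -- homomorphisms s : W(X) → W(Y), given by their values on the free generators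
  Hom-W : FinSub → FinSub → Set
  Hom-W X Y = Var X → W Y

  -- formulas: the term algebra of the Halmos signature, generated by the
  -- formal equalities w ≡ w'
  data Φ : FinSub → Set where
    _≋_  : {X : FinSub} → W X → W X → Φ X
    tt ff : {X : FinSub} → Φ X
    ∼_   : {X : FinSub} → Φ X → Φ X
    _∧_ _∨_ : {X : FinSub} → Φ X → Φ X → Φ X
    ∃̇    : {X : FinSub} → Var X → Φ X → Φ X
    _*_  : {X Y : FinSub} → Hom-W X Y → Φ X → Φ Y

  -- points μ : W(X) → H, given by their values on the free generators
  Pt : Algebra (sig Θ) → FinSub → Set
  Pt H X = Var X → Carrier H

  _∘ₛ_ : {H : Algebra (sig Θ)} {X Y : FinSub} → Pt H Y → Hom-W X Y → Pt H X
  _∘ₛ_ {H} μ s = λ x → eval H μ (s x)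

  Val : (H : Algebra (sig Θ)) {X : FinSub} → Φ X → Pred (Pt H X) 0ℓ
  Val H (w ≋ w') μ = eval H μ w ≡ eval H μ w'
  Val H tt μ = ⊤
  Val H ff μ = ⊥
  Val H (∼ u) μ = ¬ Val H u μ
  Val H (u ∧ v) μ = Val H u μ × Val H v μ
  Val H (u ∨ v) μ = Val H u μ ⊎ Val H v μ
  Val H {X} (∃̇ x u) μ =
    ∃ λ (ν : Pt H X) → ((y : Var X) → proj₁ y ≢ proj₁ x → ν y ≡ μ y) × Val H u ν
  Val H (_*_ {X} {Y} s u) μ = Val H u (_∘ₛ_ {H} {X} {Y} μ s)

  LKer : (H : Algebra (sig Θ)) {X : FinSub} → Pt H X → Pred (Φ X) 0ℓ
  LKer H μ u = Val H u μ

  TL : (H : Algebra (sig Θ)) {X : FinSub} → Pred (Φ X) 0ℓ → Pred (Pt H X) 0ℓ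
  TL H {X} T μ = (u : Φ X) → T u → LKer H μ u

  AL : (H : Algebra (sig Θ)) {X : FinSub} → Pred (Pt H X) 0ℓ → Pred (Φ X) 0ℓ
  AL H {X} A u = (μ : Pt H X) → A μ → LKer H μ u

  TLL : (H : Algebra (sig Θ)) {X : FinSub} → Pred (Φ X) 0ℓ → Pred (Φ X) 0ℓ
  TLL H T = AL H (TL H T)

  LG-equivalent : Algebra (sig Θ) → Algebra (sig Θ) → Set₁
  LG-equivalent H₁ H₂ = (X : FinSub) (T : Pred (Φ X) 0ℓ) → TLL H₁ T ≐ TLL H₂ T

  LG-isotypic : Algebra (sig Θ) → Algebra (sig Θ) → Set
  LG-isotypic H₁ H₂ =
    ((X : FinSub) (μ : Pt H₁ X) → ∃ λ (ν : Pt H₂ X) → LKer H₁ {X} μ ≐ LKer H₂ {X} ν) ×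
    ((X : FinSub) (ν : Pt H₂ X) → ∃ λ (μ : Pt H₁ X) → LKer H₂ {X} ν ≐ LKer H₁ {X} μ)

-- The logical kernel of a point is a complete theory: for every formula u it
-- contains u or ∼ u.  Hence a point ν satisfying the whole kernel of μ has
-- exactly the same kernel, and the kernel of μ (as a set of formulas T) is
-- satisfiable in H₂ as soon as ff ∉ T^{LL}_{H₂}.  LG-equivalence gives that
-- condition, since ff ∉ T^{LL}_{H₁} (μ itself satisfies T).  Conversely, T^{LL}
-- depends only on the set of kernels of points satisfying T, so equal sets of
-- kernels give equal closures.
module Submission where

open import Defs
open import Level using (0ℓ)
open import Axiom.ExcludedMiddle using (ExcludedMiddle)
open import Function.Bundles using (_⇔_; mk⇔)
open import Data.Product using (∃; _,_; proj₁; proj₂)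
open import Data.Empty using (⊥-elim)
open import Relation.Nullary using (yes; no)
open import Relation.Unary using (Pred; _⊆_; _≐_)

module _ (Θ : Variety) where
  open Logic Θ

  KernelsRealised : (H₁ H₂ : Algebra (sig Θ)) → FinSub → Set
  KernelsRealised H₁ H₂ X =
    (μ : Pt H₁ X) → ∃ λ (ν : Pt H₂ X) → LKer H₁ {X} μ ≐ LKer H₂ {X} ν

  LKer-⊆⇒≐ : ExcludedMiddle 0ℓ → {H₁ H₂ : Algebra (sig Θ)} {X : FinSub}
    {μ : Pt H₁ X} {ν : Pt H₂ X} →
    LKer H₁ {X} μ ⊆ LKer H₂ {X} ν → LKer H₁ {X} μ ≐ LKer H₂ {X} ν
  LKer-⊆⇒≐ lem {H₁} {H₂} {X} {μ} {ν} μ⊆ν = (λ {u} → μ⊆ν {u}) , (λ {u} → ν⊆μ {u})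
    where
    ν⊆μ : LKer H₂ {X} ν ⊆ LKer H₁ {X} μ
    ν⊆μ {u} ν⊨u with lem {Val H₁ u μ}
    ... | yes μ⊨u  = μ⊨u
    ... | no  μ⊭u = ⊥-elim (μ⊆ν {∼ u} μ⊭u ν⊨u)

  TLL-mono-realised : {H₁ H₂ : Algebra (sig Θ)} {X : FinSub} →
    KernelsRealised H₂ H₁ X → (T : Pred (Φ X) 0ℓ) → TLL H₁ T ⊆ TLL H₂ T
  TLL-mono-realised realised T {u} u∈TLL ν ν⊨T with realised ν
  ... | μ , ν⊆μ , μ⊆ν = μ⊆ν {u} (u∈TLL μ (λ v v∈T → ν⊆μ {v} (ν⊨T v v∈T)))

  LKer-satisfiable : ExcludedMiddle 0ℓ → {H₁ H₂ : Algebra (sig Θ)} {X : FinSub} →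
    ((T : Pred (Φ X) 0ℓ) → TLL H₂ T ⊆ TLL H₁ T) →
    (μ : Pt H₁ X) → ∃ λ (ν : Pt H₂ X) → TL H₂ (LKer H₁ {X} μ) ν
  LKer-satisfiable lem {H₁} {H₂} {X} closure⊆ μ
    with lem {∃ λ (ν : Pt H₂ X) → TL H₂ (LKer H₁ {X} μ) ν}
  ... | yes sat = sat
  ... | no unsat = ⊥-elim (ff∈TLL₁ μ (λ u μ⊨u → μ⊨u))
    where
    ff∈TLL₁ : TLL H₁ (LKer H₁ {X} μ) ff
    ff∈TLL₁ = closure⊆ (LKer H₁ {X} μ) {ff} (λ ν ν⊨T → unsat (ν , ν⊨T))

  kernels-realised : ExcludedMiddle 0ℓ → {H₁ H₂ : Algebra (sig Θ)} {X : FinSub} →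
    ((T : Pred (Φ X) 0ℓ) → TLL H₂ T ⊆ TLL H₁ T) → KernelsRealised H₁ H₂ X
  kernels-realised lem {H₁} {H₂} closure⊆ μ with LKer-satisfiable lem {H₁} {H₂} closure⊆ μ
  ... | ν , ν⊨kerμ = ν , LKer-⊆⇒≐ lem {H₁} {H₂} (λ {u} → ν⊨kerμ u)

theorem3p9 : ExcludedMiddle 0ℓ → (Θ : Variety) (H₁ H₂ : Algebra (sig Θ)) →
    InΘ Θ H₁ → InΘ Θ H₂ →
    (Logic.LG-equivalent Θ H₁ H₂ ⇔ Logic.LG-isotypic Θ H₁ H₂)
theorem3p9 lem Θ H₁ H₂ _ _ = mk⇔ equivalent⇒isotypic isotypic⇒equivalent
  where
  open Logic Θ

  equivalent⇒isotypic : LG-equivalent H₁ H₂ → LG-isotypic H₁ H₂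
  equivalent⇒isotypic equiv =
      (λ X → kernels-realised Θ lem {H₁} {H₂} (λ T {u} → proj₂ (equiv X T) {u}))
    , (λ X → kernels-realised Θ lem {H₂} {H₁} (λ T {u} → proj₁ (equiv X T) {u}))

  isotypic⇒equivalent : LG-isotypic H₁ H₂ → LG-equivalent H₁ H₂
  isotypic⇒equivalent (realised₁₂ , realised₂₁) X T =
      (λ {u} → TLL-mono-realised Θ {H₁} {H₂} (realised₂₁ X) T {u})
    , (λ {u} → TLL-mono-realised Θ {H₂} {H₁} (realised₁₂ X) T {u})
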